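{- If a $k$-uniform hypergraph $\mathcal{H}$ contains a semicycle (as a subhypergraph), then it also contains a non-self-intersecting semicycle.
   Context: Hypergraphs are finite, $k$-uniform and have no multiple edges. A nonempty $k$-uniform hypergraph $\mathcal{C}$ is a semicycle if there is a sequence $v_1,\dots,v_l$ of its vertices in which every vertex of $\mathcal{C}$ appears at least once (possibly several times), $v_1=v_l$, and the sets $\{v_i,\dots,v_{i+k-1}\}$ for $1\le i\le l-k+1$ are pairwise distinct edges of $\mathcal{C}$ and are exactly the edges of $\mathcal{C}$. A semicycle is self-intersecting if in its defining sequence some vertex appears at least twice apart from the required coincidence $v_1=v_l$; otherwise it is non-self-intersecting. -}

module Defs where

open import Data.Nat using (ℕ; zero; suc; _+_; _≤_; _<_)
open import Data.Fin using (Fin; toℕ)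
open import Data.Fin.Subset using (Subset; _∈_; _⊆_; ∣_∣)
open import Data.List using (List; length; take; drop; head; last; lookup)
open import Data.List.Membership.Propositional renaming (_∈_ to _∈L_)
open import Data.Maybe using (just)
open import Data.Product using (Σ; _×_)
open import Relation.Binary.PropositionalEquality using (_≡_; _≢_)
open import Relation.Nullary using (¬_)

-- A finite k-uniform hypergraph without multiple edges, with vertex set V ⊆ Fin n.
-- Edges are sets of vertices (Subset n), so there are no multiple edges.
record Hypergraph (n k : ℕ) : Set₁ where
  field
    V       : Subset n
    E       : Subset n → Set
    uniform : ∀ {e} → E e → ∣ e ∣ ≡ k
    edges⊆V : ∀ {e} → E e → e ⊆ V
open Hypergraph public

_≤H_ : ∀ {n k} → Hypergraph n k → Hypergraph n k → Set
C ≤H H = (V C ⊆ V H) × (∀ e → E C e → E H e)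

-- the set of vertices of the window {v_i, ..., v_{i+k-1}} (0-indexed i) of a sequence
window : ∀ {n} → ℕ → List (Fin n) → ℕ → List (Fin n)
window k s i = take k (drop i s)

SameSet : ∀ {n} → Subset n → List (Fin n) → Set
SameSet e w = ∀ v → ((v ∈ e → v ∈L w) × (v ∈L w → v ∈ e))

SameListSet : ∀ {n} → List (Fin n) → List (Fin n) → Set
SameListSet w w' = ∀ v → ((v ∈L w → v ∈L w') × (v ∈L w' → v ∈L w))

record DefiningSequence {n k : ℕ} (C : Hypergraph n k) (s : List (Fin n)) : Set where
  field
    nonempty        : Σ (Subset n) (E C)
    closed          : Σ (Fin n) (λ v → (head s ≡ just v) × (last s ≡ just v))
    ofVertices      : ∀ v → v ∈L s → v ∈ V C
    covers          : ∀ v → v ∈ V C → v ∈L s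
    windowsAreEdges : ∀ i → i + k ≤ length s →
                        Σ (Subset n) (λ e → E C e × SameSet e (window k s i))
    edgesAreWindows : ∀ e → E C e →
                        Σ ℕ (λ i → (i + k ≤ length s) × SameSet e (window k s i))
    pairwiseDistinct : ∀ i j → i + k ≤ length s → j + k ≤ length s → i ≢ j →
                        ¬ SameListSet (window k s i) (window k s j)

Semicycle : ∀ {n k} → Hypergraph n k → Set
Semicycle {n} C = Σ (List (Fin n)) (DefiningSequence C)

-- no vertex repeats except the required coincidence v_1 = v_l
NoExtraRepeats : ∀ {n} → List (Fin n) → Set
NoExtraRepeats s = ∀ (i j : Fin (length s)) → toℕ i < toℕ j → lookup s i ≡ lookup s j →
                     (toℕ i ≡ 0) × (suc (toℕ j) ≡ length s)

NonSelfIntersectingSemicycle : ∀ {n k} → Hypergraph n k → Set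
NonSelfIntersectingSemicycle {n} C =
  Σ (List (Fin n)) (λ s → DefiningSequence C s × NoExtraRepeats s)

-- Call a pair of positions a < a + g of the defining sequence s with the same vertex a return of
-- length g, and pick a shortest one (s itself returns at its endpoints). Every window of s is a
-- k-edge, so it has k distinct vertices and cannot contain a return: hence g ≥ k. The segment
-- v_a, …, v_{a+g} is therefore at least k long, its windows are windows of s (distinct edges of H),
-- and by minimality of g its only repetition is the closing one. So the segment is the defining
-- sequence of a non-self-intersecting semicycle in H whose edges are its windows.
module Submission where

open import Defs
open import Data.Nat using (ℕ; zero; suc; _+_; _∸_; _⊓_; _≤_; _<_; z≤n; s≤s; s≤s⁻¹; _≤?_; _<?_)
open import Data.Nat.Properties
open import Data.Nat.Induction using (<-rec)
open import Data.Fin using (Fin; toℕ) renaming (zero to fzero; suc to fsuc)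
open import Data.Fin.Properties using (toℕ<n) renaming (_≟_ to _≟ᶠ_)
open import Data.Fin.Subset using (Subset; _∈_; _⊆_; ∣_∣; ⁅_⁆; _∪_; ⋃; inside; outside)
open import Data.Fin.Subset.Properties
  using (x∈p∪q⁺; x∈p∪q⁻; x∈⁅x⁆; x∈⁅y⁆⇒x≡y; ∉⊥; ∣⁅x⁆∣≡1; ∣⊥∣≡0; ∣p∣≤∣x∷p∣; p⊆q⇒∣p∣≤∣q∣)
open import Data.List using (List; []; _∷_; length; take; drop; head; last; lookup; map)
open import Data.List.Properties using (length-take; length-drop; take-take; take-drop; drop-drop)
open import Data.List.Membership.Propositional renaming (_∈_ to _∈L_)
open import Data.List.Relation.Unary.Any using (here; there)
open import Data.List.Relation.Binary.Sublist.Propositional.Properties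
  using (Any-resp-⊆; take-⊆; drop-⊆)
open import Data.Maybe using (Maybe; just)
open import Data.Maybe.Properties using () renaming (≡-dec to ≡-decᴹ)
open import Data.Product using (Σ; ∃; ∃₂; _×_; _,_; proj₁; proj₂)
open import Data.Sum using (inj₁; inj₂)
open import Data.Empty using (⊥; ⊥-elim)
import Data.Vec as Vec
open import Function using (_∘_)
open import Relation.Nullary using (Dec; yes; no)
open import Relation.Nullary.Decidable using (_×-dec_; map′)
open import Relation.Unary using (Pred; Decidable)
open import Relation.Binary.PropositionalEquality

at : ∀ {A : Set} → List A → ℕ → Maybe A
at xs i = head (drop i xs)

module _ {A : Set} where

  at-∈ : ∀ (xs : List A) i {x} → at xs i ≡ just x → x ∈L xs
  at-∈ []       zero    ()
  at-∈ []       (suc i) ()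
  at-∈ (y ∷ xs) zero    refl = here refl
  at-∈ (y ∷ xs) (suc i) eq   = there (at-∈ xs i eq)

  at-<length : ∀ (xs : List A) {i} → i < length xs → ∃ λ x → at xs i ≡ just x
  at-<length (x ∷ xs) {zero}  _         = x , refl
  at-<length (x ∷ xs) {suc i} (s≤s i<n) = at-<length xs i<n

  at-lookup : ∀ (xs : List A) i → at xs (toℕ i) ≡ just (lookup xs i)
  at-lookup (x ∷ xs) fzero    = refl
  at-lookup (x ∷ xs) (fsuc i) = at-lookup xs i

  last≡at : ∀ (xs : List A) → last xs ≡ at xs (length xs ∸ 1)
  last≡at []           = refl
  last≡at (x ∷ [])     = refl
  last≡at (x ∷ y ∷ xs) = last≡at (y ∷ xs)

  at-drop : ∀ a i (xs : List A) → at (drop a xs) i ≡ at xs (a + i)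
  at-drop a i xs = cong head (drop-drop a i xs)

  at-take : ∀ m i (xs : List A) → i < m → at (take m xs) i ≡ at xs i
  at-take (suc m) i       []       _         = refl
  at-take (suc m) zero    (x ∷ xs) _         = refl
  at-take (suc m) (suc i) (x ∷ xs) (s≤s i<m) = at-take m i xs i<m

module _ {n : ℕ} where

  length-window : ∀ k (s : List (Fin n)) {a} → a + k ≤ length s → length (window k s a) ≡ k
  length-window k s {a} a+k≤l = begin
    length (take k (drop a s)) ≡⟨ length-take k (drop a s) ⟩
    k ⊓ length (drop a s)      ≡⟨ cong (k ⊓_) (length-drop a s) ⟩
    k ⊓ (length s ∸ a)         ≡⟨ m≤n⇒m⊓n≡m (m+n≤o⇒m≤o∸n k (subst (_≤ length s) (+-comm a k) a+k≤l)) ⟩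
    k                          ∎
    where open ≡-Reasoning

  at-window : ∀ k (s : List (Fin n)) a {i} → i < k → at (window k s a) i ≡ at s (a + i)
  at-window k s a {i} i<k = trans (at-take k i (drop a s) i<k) (at-drop a i s)

  window-window : ∀ k m (s : List (Fin n)) a {i} → i + k ≤ m →
                  window k (window m s a) i ≡ window k s (a + i)
  window-window k m s a {i} i+k≤m = begin
    take k (drop i (take m (drop a s)))       ≡⟨ take-drop k i _ ⟩
    drop i (take (i + k) (take m (drop a s))) ≡⟨ cong (drop i) (take-take (i + k) m _) ⟩
    drop i (take ((i + k) ⊓ m) (drop a s))    ≡⟨ cong (λ j → drop i (take j (drop a s))) (m≤n⇒m⊓n≡m i+k≤m) ⟩
    drop i (take (i + k) (drop a s))          ≡⟨ take-drop k i (drop a s) ⟨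
    take k (drop i (drop a s))                ≡⟨ cong (take k) (drop-drop a i s) ⟩
    take k (drop (a + i) s)                   ∎
    where open ≡-Reasoning

  ∈-window : ∀ k (s : List (Fin n)) a {v} → v ∈L window k s a → v ∈L s
  ∈-window k s a = Any-resp-⊆ (drop-⊆ a s) ∘ Any-resp-⊆ (take-⊆ k (drop a s))

∣p∪q∣≤∣p∣+∣q∣ : ∀ {n} (p q : Subset n) → ∣ p ∪ q ∣ ≤ ∣ p ∣ + ∣ q ∣
∣p∪q∣≤∣p∣+∣q∣ Vec.[]            Vec.[]            = z≤n
∣p∪q∣≤∣p∣+∣q∣ (outside Vec.∷ p) (outside Vec.∷ q) = ∣p∪q∣≤∣p∣+∣q∣ p q
∣p∪q∣≤∣p∣+∣q∣ (outside Vec.∷ p) (inside Vec.∷ q)  =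
  subst (∣ p ∪ q ∣ <_) (sym (+-suc ∣ p ∣ ∣ q ∣)) (s≤s (∣p∪q∣≤∣p∣+∣q∣ p q))
∣p∪q∣≤∣p∣+∣q∣ (inside Vec.∷ p)  (x Vec.∷ q)       =
  s≤s (≤-trans (∣p∪q∣≤∣p∣+∣q∣ p q) (+-monoʳ-≤ ∣ p ∣ (∣p∣≤∣x∷p∣ x q)))

toSubset : ∀ {n} → List (Fin n) → Subset n
toSubset = ⋃ ∘ map ⁅_⁆

module _ {n : ℕ} where

  ∈-toSubset⁺ : ∀ {xs : List (Fin n)} {v} → v ∈L xs → v ∈ toSubset xs
  ∈-toSubset⁺ {x ∷ xs} (here refl) = x∈p∪q⁺ (inj₁ (x∈⁅x⁆ x))
  ∈-toSubset⁺ {x ∷ xs} (there v∈) = x∈p∪q⁺ (inj₂ (∈-toSubset⁺ v∈))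

  ∈-toSubset⁻ : ∀ {xs : List (Fin n)} {v} → v ∈ toSubset xs → v ∈L xs
  ∈-toSubset⁻ {[]}     v∈ = ⊥-elim (∉⊥ v∈)
  ∈-toSubset⁻ {x ∷ xs} v∈ with x∈p∪q⁻ ⁅ x ⁆ (toSubset xs) v∈
  ... | inj₁ v∈⁅x⁆ = here (x∈⁅y⁆⇒x≡y x v∈⁅x⁆)
  ... | inj₂ v∈xs  = there (∈-toSubset⁻ v∈xs)

  ∣toSubset-∷∣≤ : ∀ x (xs : List (Fin n)) → ∣ toSubset (x ∷ xs) ∣ ≤ suc ∣ toSubset xs ∣
  ∣toSubset-∷∣≤ x xs =
    subst (λ c → ∣ toSubset (x ∷ xs) ∣ ≤ c + ∣ toSubset xs ∣) (∣⁅x⁆∣≡1 x)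
          (∣p∪q∣≤∣p∣+∣q∣ ⁅ x ⁆ (toSubset xs))

  ∣toSubset∣≤length : ∀ (xs : List (Fin n)) → ∣ toSubset xs ∣ ≤ length xs
  ∣toSubset∣≤length []       = ≤-reflexive (∣⊥∣≡0 n)
  ∣toSubset∣≤length (x ∷ xs) = ≤-trans (∣toSubset-∷∣≤ x xs) (s≤s (∣toSubset∣≤length xs))

  repeat⇒∣toSubset∣<length : ∀ (xs : List (Fin n)) {p q} → p < q → p < length xs →
                             at xs p ≡ at xs q → ∣ toSubset xs ∣ < length xs
  repeat⇒∣toSubset∣<length (x ∷ xs) {zero} {suc q} _ _ x≡xs[q] =
    s≤s (≤-trans (p⊆q⇒∣p∣≤∣q∣ x∷xs⊆xs) (∣toSubset∣≤length xs))
    where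
      x∷xs⊆xs : toSubset (x ∷ xs) ⊆ toSubset xs
      x∷xs⊆xs v∈ with ∈-toSubset⁻ {x ∷ xs} v∈
      ... | here refl = ∈-toSubset⁺ (at-∈ xs q (sym x≡xs[q]))
      ... | there v∈xs = ∈-toSubset⁺ v∈xs
  repeat⇒∣toSubset∣<length (x ∷ xs) {suc p} {suc q} (s≤s p<q) (s≤s p<l) eq =
    s≤s (≤-trans (∣toSubset-∷∣≤ x xs) (repeat⇒∣toSubset∣<length xs p<q p<l eq))

window-covering : ∀ {k l a g} → k ≤ l → a + g < l → g < k →
                  ∃₂ λ w p → w + p ≡ a × p + g < k × w + k ≤ l
window-covering {k} {l} {a} {g} k≤l a+g<l g<k with a + k ≤? l
... | yes a+k≤l = a , 0 , +-identityʳ a , g<k , a+k≤l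
... | no a+k≰l  = w , a ∸ w , w+p≡a , +-cancelˡ-< w _ k w+[p+g]<w+k , ≤-reflexive (m∸n+n≡m k≤l)
  where
    w : ℕ
    w = l ∸ k
    w+p≡a : w + (a ∸ w) ≡ a
    w+p≡a = m+[n∸m]≡n (subst (w ≤_) (m+n∸n≡m a k) (∸-monoˡ-≤ k (<⇒≤ (≰⇒> a+k≰l))))
    w+[p+g]<w+k : w + (a ∸ w + g) < w + k
    w+[p+g]<w+k = subst₂ _<_ (trans (cong (_+ g) (sym w+p≡a)) (+-assoc w (a ∸ w) g))
                             (sym (m∸n+n≡m k≤l)) a+g<l

least-witness : ∀ {p} {P : Pred ℕ p} → Decidable P → ∀ {m} → P m →
                ∃ λ d → P d × (∀ {d′} → P d′ → d ≤ d′)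
least-witness {P = P} P? {m} = <-rec Goal step m
  where
    Goal : ℕ → Set _
    Goal m = P m → ∃ λ d → P d × (∀ {d′} → P d′ → d ≤ d′)
    step : ∀ m → (∀ {m′} → m′ < m → Goal m′) → Goal m
    step m rec Pm with anyUpTo? P? m
    ... | yes (d , d<m , Pd) = rec d<m Pd
    ... | no none            = m , Pm , λ Pd′ → ≮⇒≥ λ d′<m → none (_ , d′<m , Pd′)

windowHypergraph : ∀ {n k} → Hypergraph n k → List (Fin n) → Hypergraph n k
windowHypergraph {k = k} H t = record
  { V       = toSubset t
  ; E       = λ e → E H e × ∃ λ i → i + k ≤ length t × SameSet e (window k t i)
  ; uniform = uniform H ∘ proj₁
  ; edges⊆V = λ (_ , i , _ , e≈) v∈e → ∈-toSubset⁺ (∈-window k t i (proj₁ (e≈ _) v∈e))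
  }

module _ {n k} {C : Hypergraph n k} {s : List (Fin n)} (D : DefiningSequence C s) where
  open DefiningSequence D

  k≤length : k ≤ length s
  k≤length with nonempty
  ... | e , Ce with edgesAreWindows e Ce
  ...   | i , i+k≤l , _ = m+n≤o⇒n≤o i i+k≤l

  window-repeat-free : ∀ {w p q} → w + k ≤ length s → p < q → q < k →
                       at s (w + p) ≡ at s (w + q) → ⊥
  window-repeat-free {w} {p} {q} w+k≤l p<q q<k eq with windowsAreEdges w w+k≤l
  ... | e , Ce , e≈ = <-irrefl refl (begin-strict
    k                      ≡⟨ uniform C Ce ⟨
    ∣ e ∣                  ≤⟨ p⊆q⇒∣p∣≤∣q∣ (∈-toSubset⁺ ∘ proj₁ (e≈ _)) ⟩
    ∣ toSubset win ∣       <⟨ repeat⇒∣toSubset∣<length win p<q p<length win-repeat ⟩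
    length win             ≡⟨ length-window k s w+k≤l ⟩
    k                      ∎)
    where
      open ≤-Reasoning
      win : List (Fin n)
      win = window k s w
      p<length : p < length win
      p<length = subst (p <_) (sym (length-window k s w+k≤l)) (<-trans p<q q<k)
      win-repeat : at win p ≡ at win q
      win-repeat = trans (at-window k s w (<-trans p<q q<k)) (trans eq (sym (at-window k s w q<k)))

  Returns : ℕ → ℕ → Set
  Returns g a = 0 < g × a + g < length s × at s a ≡ at s (a + g)

  returns? : ∀ g a → Dec (Returns g a)
  returns? g a = 0 <? g ×-dec a + g <? length s ×-dec ≡-decᴹ _≟ᶠ_ (at s a) (at s (a + g))

  closing-return : ∀ {g} → suc g ≡ length s → 0 < g → Returns g 0
  closing-return {g} 1+g≡l 0<g with closed
  ... | v , head≡v , last≡v = 0<g , subst (g <_) 1+g≡l ≤-refl , (begin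
    head s                 ≡⟨ trans head≡v (sym last≡v) ⟩
    last s                 ≡⟨ last≡at s ⟩
    at s (length s ∸ 1)    ≡⟨ cong (λ l → at s (l ∸ 1)) 1+g≡l ⟨
    at s g                 ∎)
    where open ≡-Reasoning

  shortest-return : ∀ g a → Returns g a →
                    ∃₂ λ g a → Returns g a × (∀ {g′ a′} → Returns g′ a′ → g ≤ g′)
  shortest-return g a r with least-witness returnsSomewhere? (a , r)
    where
      returnsSomewhere? : ∀ g → Dec (∃ (Returns g))
      returnsSomewhere? g = map′ (λ (a , _ , r) → a , r)
                                 (λ (a , r) → a , m+n≤o⇒m≤o (suc a) (proj₁ (proj₂ r)) , r)
                                 (anyUpTo? (returns? g) (length s))
  ... | g , (a , r) , least = g , a , r , λ r′ → least (_ , r′)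

  return-length≥k : ∀ {g a} → Returns g a → k ≤ g
  return-length≥k {g} {a} (0<g , a+g<l , a≡a+g) = ≮⇒≥ λ g<k →
    let w , p , w+p≡a , p+g<k , w+k≤l = window-covering k≤length a+g<l g<k
    in window-repeat-free w+k≤l (m<m+n p 0<g) p+g<k
         (subst₂ (λ i j → at s i ≡ at s j) (sym w+p≡a)
                 (trans (cong (_+ g) (sym w+p≡a)) (+-assoc w p g)) a≡a+g)

  segment : ℕ → ℕ → List (Fin n)
  segment g a = window (suc g) s a

  module Segment (g a : ℕ) (a+g<l : a + g < length s) where

    a+[1+g]≤l : a + suc g ≤ length s
    a+[1+g]≤l = subst (_≤ length s) (sym (+-suc a g)) a+g<l

    length-segment : length (segment g a) ≡ suc g
    length-segment = length-window (suc g) s a+[1+g]≤l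

    at-segment : ∀ {i} → i < suc g → at (segment g a) i ≡ at s (a + i)
    at-segment = at-window (suc g) s a

    segment-bound : ∀ {i} → i + k ≤ length (segment g a) → (a + i) + k ≤ length s
    segment-bound {i} i+k≤m = begin
      (a + i) + k   ≡⟨ +-assoc a i k ⟩
      a + (i + k)   ≤⟨ +-monoʳ-≤ a (subst (i + k ≤_) length-segment i+k≤m) ⟩
      a + suc g     ≤⟨ a+[1+g]≤l ⟩
      length s      ∎
      where open ≤-Reasoning

    segment-window : ∀ {i} → i + k ≤ length (segment g a) →
                     window k (segment g a) i ≡ window k s (a + i)
    segment-window i+k≤m = window-window k (suc g) s a (subst (_ ≤_) length-segment i+k≤m)

  segment-noExtraRepeats : ∀ g a → Returns g a → (∀ {g′ a′} → Returns g′ a′ → g ≤ g′) →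
                           NoExtraRepeats (segment g a)
  segment-noExtraRepeats g a (_ , a+g<l , _) shortest i j i<j tᵢ≡tⱼ =
    n≤0⇒n≡0 (+-cancelʳ-≤ g (toℕ i) 0 i+g≤g) , trans (cong suc j≡g) (sym length-segment)
    where
      open Segment g a a+g<l
      t : List (Fin n)
      t = segment g a
      j<1+g : toℕ j < suc g
      j<1+g = subst (toℕ j <_) length-segment (toℕ<n j)
      i+[j∸i]≡j : toℕ i + (toℕ j ∸ toℕ i) ≡ toℕ j
      i+[j∸i]≡j = m+[n∸m]≡n (<⇒≤ i<j)
      inner-return : Returns (toℕ j ∸ toℕ i) (a + toℕ i)
      inner-return = m<n⇒0<n∸m i<j , inner-bound , (begin
        at s (a + toℕ i)                     ≡⟨ at-segment (<-trans i<j j<1+g) ⟨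
        at t (toℕ i)                         ≡⟨ at-lookup t i ⟩
        just (lookup t i)                    ≡⟨ cong just tᵢ≡tⱼ ⟩
        just (lookup t j)                    ≡⟨ at-lookup t j ⟨
        at t (toℕ j)                         ≡⟨ at-segment j<1+g ⟩
        at s (a + toℕ j)                     ≡⟨ cong (at s) a+i+[j∸i]≡a+j ⟨
        at s (a + toℕ i + (toℕ j ∸ toℕ i))   ∎)
        where
          open ≡-Reasoning
          a+i+[j∸i]≡a+j : a + toℕ i + (toℕ j ∸ toℕ i) ≡ a + toℕ j
          a+i+[j∸i]≡a+j = trans (+-assoc a (toℕ i) _) (cong (a +_) i+[j∸i]≡j)
          inner-bound : a + toℕ i + (toℕ j ∸ toℕ i) < length s
          inner-bound = subst (_< length s) (sym a+i+[j∸i]≡a+j)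
                              (<-≤-trans (+-monoʳ-< a j<1+g) a+[1+g]≤l)
      g≤j∸i : g ≤ toℕ j ∸ toℕ i
      g≤j∸i = shortest inner-return
      i+g≤g : toℕ i + g ≤ 0 + g
      i+g≤g = ≤-trans (+-monoʳ-≤ (toℕ i) g≤j∸i) (≤-trans (≤-reflexive i+[j∸i]≡j) (s≤s⁻¹ j<1+g))
      j≡g : toℕ j ≡ g
      j≡g = ≤-antisym (s≤s⁻¹ j<1+g) (≤-trans g≤j∸i (m∸n≤m (toℕ j) (toℕ i)))

module _ {n k} (H : Hypergraph n k) {C : Hypergraph n k} (C≤H : C ≤H H)
         {s : List (Fin n)} (D : DefiningSequence C s) where
  open DefiningSequence D

  segment-≤H : ∀ g a → windowHypergraph H (segment D g a) ≤H H
  segment-≤H g a = (λ v∈t → proj₁ C≤H (ofVertices _ (∈-window (suc g) s a (∈-toSubset⁻ v∈t))))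
                 , λ _ → proj₁

  segment-definingSequence : ∀ g a → Returns D g a →
                             DefiningSequence (windowHypergraph H (segment D g a)) (segment D g a)
  segment-definingSequence g a r@(_ , a+g<l , a≡a+g) = record
    { nonempty         = let e , Ee , _ = window-edge 0 (subst (k ≤_) (sym length-segment) k≤1+g)
                         in e , Ee
    ; closed           = x , head≡x , last≡x
    ; ofVertices       = λ _ → ∈-toSubset⁺
    ; covers           = λ _ → ∈-toSubset⁻
    ; windowsAreEdges  = window-edge
    ; edgesAreWindows  = λ _ → proj₂
    ; pairwiseDistinct = λ i j i+k≤m j+k≤m i≢j same →
        pairwiseDistinct (a + i) (a + j) (segment-bound i+k≤m) (segment-bound j+k≤m)
          (i≢j ∘ +-cancelˡ-≡ a i j)
          (subst₂ SameListSet (segment-window i+k≤m) (segment-window j+k≤m) same)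
    }
    where
      open Segment D g a a+g<l
      t : List (Fin n)
      t = segment D g a
      k≤1+g : k ≤ suc g
      k≤1+g = m≤n⇒m≤1+n (return-length≥k D r)
      window-edge : ∀ i → i + k ≤ length t →
                    ∃ λ e → E (windowHypergraph H t) e × SameSet e (window k t i)
      window-edge i i+k≤m with windowsAreEdges (a + i) (segment-bound i+k≤m)
      ... | e , Ce , e≈ = e , (proj₂ C≤H e Ce , i , i+k≤m , e≈′) , e≈′
        where
          e≈′ : SameSet e (window k t i)
          e≈′ = subst (SameSet e) (sym (segment-window i+k≤m)) e≈
      x : Fin n
      x = proj₁ (at-<length s (m+n≤o⇒m≤o (suc a) a+g<l))
      s[a]≡x : at s a ≡ just x
      s[a]≡x = proj₂ (at-<length s (m+n≤o⇒m≤o (suc a) a+g<l))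
      head≡x : head t ≡ just x
      head≡x = trans (at-segment (s≤s z≤n)) (trans (cong (at s) (+-identityʳ a)) s[a]≡x)
      last≡x : last t ≡ just x
      last≡x = begin
        last t                  ≡⟨ last≡at t ⟩
        at t (length t ∸ 1)     ≡⟨ cong (λ m → at t (m ∸ 1)) length-segment ⟩
        at t g                  ≡⟨ at-segment ≤-refl ⟩
        at s (a + g)            ≡⟨ trans (sym a≡a+g) s[a]≡x ⟩
        just x                  ∎
        where open ≡-Reasoning

mainTheorem3 : ∀ {n k : ℕ} (H : Hypergraph n k) →
                 Σ (Hypergraph n k) (λ C → (C ≤H H) × Semicycle C) →
                 Σ (Hypergraph n k) (λ C → (C ≤H H) × NonSelfIntersectingSemicycle C)
mainTheorem3 H (C , C≤H , [] , D) with DefiningSequence.closed D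
... | _ , () , _
mainTheorem3 H (C , C≤H , x ∷ [] , D) = C , C≤H , x ∷ [] , D , λ { fzero fzero () _ }
mainTheorem3 H (C , C≤H , _ ∷ _ ∷ _ , D) =
  let g , a , r , shortest = shortest-return D _ 0 (closing-return D refl (s≤s z≤n))
  in windowHypergraph H (segment D g a) , segment-≤H H C≤H D g a ,
     segment D g a , segment-definingSequence H C≤H D g a r , segment-noExtraRepeats D g a r shortest
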